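{- Let $(A,\mathbf a),(A,\mathbf b)\in\tilde\Delta$. Then $\tilde\Gamma(A,\mathbf a)\tilde\Gamma=\tilde\Gamma(A,\mathbf b)\tilde\Gamma$ if and only if there exists $X\in\Gamma^A$ with $X*\mathbf a\equiv\mathbf b\pmod{A\mathcal M+\mathcal MA}$, where $X*\mathbf a=X\mathbf aA^{ -1}X^{ -1}A$.
   Context: $G$ is a group, $\Delta$ a submonoid, $\Gamma$ a subgroup of $\Delta$ such that for every $A\in\Delta$ the sets $\Gamma\backslash\Gamma A\Gamma$ and $\Gamma A\Gamma/\Gamma$ are finite. $\mathcal M$ is a two-sided $\Delta$-module (an abelian group with commuting left and right additive $\Delta$-actions), such that $\mathcal M/(A\mathcal M\cap\mathcal MA)$ is finite for all $A\in\Delta$ and $\mathcal M$ is a sub-$\Delta$-module of a two-sided $G$-module $\mathcal M'$ (products such as $X\mathbf aA^{ -1}X^{ -1}A$ are computed in $\mathcal M'$). $\tilde\Delta=\Delta\times\mathcal M$ with product $(A,\mathbf a)(B,\mathbf b)=(AB,A\mathbf b+\mathbf aB)$, $\tilde\Gamma=\Gamma\times\mathcal M\subset\tilde\Delta$ (a subgroup). $\Gamma^A=\Gamma\cap A\Gamma A^{ -1}$. -}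

module Defs where

open import Level using (Level; _⊔_) renaming (suc to lsuc)
open import Algebra.Bundles using (Group; AbelianGroup)
open import Data.Product using (Σ; ∃; _×_; _,_)
open import Data.List using (List)
open import Data.List.Relation.Unary.Any using (Any)
open import Relation.Unary using (Pred; _⊆_)
open import Function.Bundles using (_⇔_)

record TwoSidedModule {c ℓ : Level} (G : Group c ℓ) : Set (lsuc (c ⊔ ℓ)) where
  private module G = Group G
  field
    Mod : AbelianGroup c ℓ
  open AbelianGroup Mod public
    using () renaming (Carrier to M'; _≈_ to _≈ₘ_; _∙_ to _+_; ε to 0ₘ; _⁻¹ to -_)
  infixl 7 _·_
  infixl 7 _◃_
  field
    _·_ : G.Carrier → M' → M'
    _◃_ : M' → G.Carrier → M'
    ·-cong   : ∀ {g h x y} → g G.≈ h → x ≈ₘ y → (g · x) ≈ₘ (h · y)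
    ◃-cong   : ∀ {g h x y} → g G.≈ h → x ≈ₘ y → (x ◃ g) ≈ₘ (y ◃ h)
    ·-identity : ∀ x → (G.ε · x) ≈ₘ x
    ◃-identity : ∀ x → (x ◃ G.ε) ≈ₘ x
    ·-assoc  : ∀ g h x → ((g G.∙ h) · x) ≈ₘ (g · (h · x))
    ◃-assoc  : ∀ x g h → (x ◃ (g G.∙ h)) ≈ₘ ((x ◃ g) ◃ h)
    ·-additive : ∀ g x y → (g · (x + y)) ≈ₘ ((g · x) + (g · y))
    ◃-additive : ∀ x y g → ((x + y) ◃ g) ≈ₘ ((x ◃ g) + (y ◃ g))
    ·◃-commute : ∀ g x h → ((g · x) ◃ h) ≈ₘ (g · (x ◃ h))

record Setting (c ℓ : Level) : Set (lsuc (c ⊔ ℓ)) where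
  field
    G : Group c ℓ
  open Group G public
  field
    Δ : Pred Carrier ℓ
    Δ-resp : ∀ {x y} → x ≈ y → Δ x → Δ y
    Δ-ε : Δ ε
    Δ-∙ : ∀ {x y} → Δ x → Δ y → Δ (x ∙ y)
    Γ : Pred Carrier ℓ
    Γ-resp : ∀ {x y} → x ≈ y → Γ x → Γ y
    Γ⊆Δ : Γ ⊆ Δ
    Γ-ε : Γ ε
    Γ-∙ : ∀ {x y} → Γ x → Γ y → Γ (x ∙ y)
    Γ-⁻¹ : ∀ {x} → Γ x → Γ (x ⁻¹)
    TSM : TwoSidedModule G
  open TwoSidedModule TSM public
  field
    M : Pred M' ℓ
    M-resp : ∀ {x y} → x ≈ₘ y → M x → M y
    M-0 : M 0ₘ
    M-+ : ∀ {x y} → M x → M y → M (x + y)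
    M-neg : ∀ {x} → M x → M (- x)
    M-· : ∀ {A x} → Δ A → M x → M (A · x)
    M-◃ : ∀ {A x} → Δ A → M x → M (x ◃ A)
  InΓAΓ : Carrier → Carrier → Set (c ⊔ ℓ)
  InΓAΓ A x = ∃ λ g → ∃ λ h → Γ g × Γ h × x ≈ ((g ∙ A) ∙ h)
  InΓ· : Carrier → Carrier → Set (c ⊔ ℓ)
  InΓ· y x = ∃ λ g → Γ g × x ≈ (g ∙ y)
  In·Γ : Carrier → Carrier → Set (c ⊔ ℓ)
  In·Γ y x = ∃ λ g → Γ g × x ≈ (y ∙ g)
  InAM∩MA : Carrier → M' → Set (c ⊔ ℓ)
  InAM∩MA A x = (∃ λ m → M m × x ≈ₘ (A · m)) × (∃ λ n → M n × x ≈ₘ (n ◃ A))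
  field
    -- Γ\ΓAΓ finite: ΓAΓ is covered by finitely many right cosets Γy
    finite-left : ∀ {A} → Δ A → ∃ λ (ys : List Carrier) →
      ∀ x → InΓAΓ A x → Any (λ y → InΓ· y x) ys
    -- ΓAΓ/Γ finite: ΓAΓ is covered by finitely many left cosets yΓ
    finite-right : ∀ {A} → Δ A → ∃ λ (ys : List Carrier) →
      ∀ x → InΓAΓ A x → Any (λ y → In·Γ y x) ys
    -- M/(AM ∩ MA) finite
    finite-quot : ∀ {A} → Δ A → ∃ λ (ys : List M') →
      ∀ x → M x → Any (λ y → M y × InAM∩MA A (x + (- y))) ys

  -- Δ̃ = Δ × M with product (A,a)(B,b) = (AB, Ab + aB); computed in G × M'
  _⊗_ : Carrier × M' → Carrier × M' → Carrier × M'
  (A , a) ⊗ (B , b) = (A ∙ B , (A · b) + (a ◃ B))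

  _≈̃_ : Carrier × M' → Carrier × M' → Set ℓ
  (A , a) ≈̃ (B , b) = (A ≈ B) × (a ≈ₘ b)

  InΓ̃ : Pred (Carrier × M') ℓ
  InΓ̃ (g , m) = Γ g × M m

  InDoubleCoset : Carrier × M' → Carrier × M' → Set (c ⊔ ℓ)
  InDoubleCoset α ξ = ∃ λ γ → ∃ λ δ → InΓ̃ γ × InΓ̃ δ × ξ ≈̃ ((γ ⊗ α) ⊗ δ)

  DoubleCosetEq : Carrier × M' → Carrier × M' → Set (c ⊔ ℓ)
  DoubleCosetEq α β = ∀ ξ → InDoubleCoset α ξ ⇔ InDoubleCoset β ξ

  InΓ^ : Carrier → Carrier → Set (c ⊔ ℓ)
  InΓ^ A X = Γ X × (∃ λ g → Γ g × X ≈ ((A ∙ g) ∙ (A ⁻¹)))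

  star : Carrier → Carrier → M' → M'
  star A X a = (X · a) ◃ (((A ⁻¹) ∙ (X ⁻¹)) ∙ A)

  CongMod : Carrier → M' → M' → Set (c ⊔ ℓ)
  CongMod A x y = ∃ λ m → ∃ λ n → M m × M n × (x + (- y)) ≈ₘ ((A · m) + (n ◃ A))

{-# OPTIONS --safe #-}
module Submission where

-- Δ̃ lies in the group G̃ = G × M' with the same product, and Γ̃ is a subgroup of G̃,
-- so Γ̃(A , a)Γ̃ = Γ̃(A , b)Γ̃ iff (A , b) ∈ Γ̃(A , a)Γ̃. A product (X , m)(A , a)(Y , n)
-- has first component A iff XAY = A, i.e. X ∈ Γ^A with Y = A⁻¹X⁻¹A, and its second
-- component is then X * a + A(Y⁻¹n) + (mX⁻¹)A. As m and n range over M so do mX⁻¹ and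
-- Y⁻¹n, whence the condition X * a ≡ b mod AM + MA.

open import Defs
open import Level using (_⊔_)
open import Data.Product using (∃; _×_; _,_; proj₂)
open import Function.Bundles using (_⇔_; mk⇔; Equivalence)
open import Function.Construct.Composition using (_⇔-∘_)
open import Algebra.Bundles using (Group; AbelianGroup)
open import Relation.Unary using (Pred)
import Algebra.Properties.Group as GroupProperties
import Algebra.Properties.AbelianGroup as AbelianGroupProperties
import Algebra.Properties.CommutativeSemigroup as CommutativeSemigroupProperties
import Relation.Binary.Reasoning.Setoid as SetoidReasoning

module GroupHomomorphism {c ℓ} (H : Group c ℓ) where
  open Group H
  open GroupProperties H using (identityʳ-unique; inverseʳ-unique)

  module _ {f : Carrier → Carrier} (f-cong : ∀ {x y} → x ≈ y → f x ≈ f y)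
           (f-homo : ∀ x y → f (x ∙ y) ≈ f x ∙ f y) where

    ε-homo : f ε ≈ ε
    ε-homo = identityʳ-unique (f ε) (f ε) (trans (sym (f-homo ε ε)) (f-cong (identityˡ ε)))

    ⁻¹-homo : ∀ x → f (x ⁻¹) ≈ f x ⁻¹
    ⁻¹-homo x = inverseʳ-unique (f x) (f (x ⁻¹))
      (trans (sym (f-homo x (x ⁻¹))) (trans (f-cong (inverseʳ x)) ε-homo))

module Stabiliser {c ℓ} (H : Group c ℓ) where
  open Group H
  open GroupProperties H
  open SetoidReasoning setoid

  module _ {x a y} (xay≈a : x ∙ a ∙ y ≈ a) where

    x∙a≈a∙y⁻¹ : x ∙ a ≈ a ∙ y ⁻¹
    x∙a≈a∙y⁻¹ = trans (sym (//-rightDividesʳ y (x ∙ a))) (∙-congʳ xay≈a)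

    a∙y≈x⁻¹∙a : a ∙ y ≈ x ⁻¹ ∙ a
    a∙y≈x⁻¹∙a = begin
      a ∙ y                ≈⟨ \\-leftDividesʳ x (a ∙ y) ⟨
      x ⁻¹ ∙ (x ∙ (a ∙ y)) ≈⟨ ∙-congˡ (assoc x a y) ⟨
      x ⁻¹ ∙ (x ∙ a ∙ y)   ≈⟨ ∙-congˡ xay≈a ⟩
      x ⁻¹ ∙ a             ∎

    a⁻¹∙x⁻¹∙a≈y : a ⁻¹ ∙ x ⁻¹ ∙ a ≈ y
    a⁻¹∙x⁻¹∙a≈y = begin
      a ⁻¹ ∙ x ⁻¹ ∙ a   ≈⟨ assoc (a ⁻¹) (x ⁻¹) a ⟩
      a ⁻¹ ∙ (x ⁻¹ ∙ a) ≈⟨ ∙-congˡ a∙y≈x⁻¹∙a ⟨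
      a ⁻¹ ∙ (a ∙ y)    ≈⟨ \\-leftDividesʳ a y ⟩
      y                 ∎

    x≈a∙y⁻¹∙a⁻¹ : x ≈ a ∙ y ⁻¹ ∙ a ⁻¹
    x≈a∙y⁻¹∙a⁻¹ = trans (sym (//-rightDividesʳ a x)) (∙-congʳ x∙a≈a∙y⁻¹)

  x≈a∙z∙a⁻¹⇒x∙a∙z⁻¹≈a : ∀ {x a z} → x ≈ a ∙ z ∙ a ⁻¹ → x ∙ a ∙ z ⁻¹ ≈ a
  x≈a∙z∙a⁻¹⇒x∙a∙z⁻¹≈a {x} {a} {z} x≈aza⁻¹ = begin
    x ∙ a ∙ z ⁻¹            ≈⟨ ∙-congʳ (∙-congʳ x≈aza⁻¹) ⟩
    a ∙ z ∙ a ⁻¹ ∙ a ∙ z ⁻¹ ≈⟨ ∙-congʳ (//-rightDividesˡ a (a ∙ z)) ⟩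
    a ∙ z ∙ z ⁻¹            ≈⟨ //-rightDividesʳ z a ⟩
    a                       ∎

module DoubleCosets {c ℓ} (H : Group c ℓ) where
  open Group H
  open GroupProperties H
  open SetoidReasoning setoid

  module _ {ℓ′} (S : Pred Carrier ℓ′) where

    DoubleCoset : Carrier → Carrier → Set (c ⊔ ℓ ⊔ ℓ′)
    DoubleCoset a x = ∃ λ g → ∃ λ h → S g × S h × x ≈ g ∙ a ∙ h

    module _ (S-ε : S ε) (S-∙ : ∀ {x y} → S x → S y → S (x ∙ y))
             (S-⁻¹ : ∀ {x} → S x → S (x ⁻¹)) where

      doubleCoset-refl : ∀ a → DoubleCoset a a
      doubleCoset-refl a = ε , ε , S-ε , S-ε ,
        sym (trans (identityʳ (ε ∙ a)) (identityˡ a))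

      doubleCoset-sym : ∀ {a b} → DoubleCoset a b → DoubleCoset b a
      doubleCoset-sym {a} {b} (g , h , Sg , Sh , b≈gah) =
        g ⁻¹ , h ⁻¹ , S-⁻¹ Sg , S-⁻¹ Sh , (begin
          a                         ≈⟨ \\-leftDividesʳ g a ⟨
          g ⁻¹ ∙ (g ∙ a)            ≈⟨ ∙-congˡ (//-rightDividesʳ h (g ∙ a)) ⟨
          g ⁻¹ ∙ (g ∙ a ∙ h ∙ h ⁻¹) ≈⟨ assoc (g ⁻¹) (g ∙ a ∙ h) (h ⁻¹) ⟨
          g ⁻¹ ∙ (g ∙ a ∙ h) ∙ h ⁻¹ ≈⟨ ∙-congʳ (∙-congˡ b≈gah) ⟨
          g ⁻¹ ∙ b ∙ h ⁻¹           ∎)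

      doubleCoset-trans : ∀ {a b x} → DoubleCoset a b → DoubleCoset b x → DoubleCoset a x
      doubleCoset-trans {a} {b} {x} (g , h , Sg , Sh , b≈gah) (g′ , h′ , Sg′ , Sh′ , x≈g′bh′) =
        g′ ∙ g , h ∙ h′ , S-∙ Sg′ Sg , S-∙ Sh Sh′ , (begin
          x                        ≈⟨ x≈g′bh′ ⟩
          g′ ∙ b ∙ h′              ≈⟨ ∙-congʳ (∙-congˡ b≈gah) ⟩
          g′ ∙ (g ∙ a ∙ h) ∙ h′    ≈⟨ ∙-congʳ (assoc g′ (g ∙ a) h) ⟨
          g′ ∙ (g ∙ a) ∙ h ∙ h′    ≈⟨ ∙-congʳ (∙-congʳ (assoc g′ g a)) ⟨
          g′ ∙ g ∙ a ∙ h ∙ h′      ≈⟨ assoc (g′ ∙ g ∙ a) h h′ ⟩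
          g′ ∙ g ∙ a ∙ (h ∙ h′)    ∎)

      doubleCoset-eq : ∀ {a b} → DoubleCoset a b → ∀ x → DoubleCoset a x ⇔ DoubleCoset b x
      doubleCoset-eq b∈SaS x =
        mk⇔ (doubleCoset-trans (doubleCoset-sym b∈SaS)) (doubleCoset-trans b∈SaS)

      doubleCosets-equal⇔ : ∀ {a b} → (∀ x → DoubleCoset a x ⇔ DoubleCoset b x) ⇔ DoubleCoset a b
      doubleCosets-equal⇔ {b = b} =
        mk⇔ (λ same → Equivalence.from (same b) (doubleCoset-refl b)) doubleCoset-eq

module Differences {c ℓ} (H : AbelianGroup c ℓ) where
  open AbelianGroup H
  open GroupProperties group using (\\-leftDividesˡ; ⁻¹-involutive)
  open AbelianGroupProperties H using (⁻¹-∙-comm)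

  y≈x∙z⇒x∙y⁻¹≈z⁻¹ : ∀ {x y z} → y ≈ x ∙ z → x ∙ y ⁻¹ ≈ z ⁻¹
  y≈x∙z⇒x∙y⁻¹≈z⁻¹ {x} {y} {z} y≈xz = begin
    x ∙ y ⁻¹          ≈⟨ ∙-congˡ (⁻¹-cong y≈xz) ⟩
    x ∙ (x ∙ z) ⁻¹    ≈⟨ ∙-congˡ (⁻¹-∙-comm x z) ⟨
    x ∙ (x ⁻¹ ∙ z ⁻¹) ≈⟨ \\-leftDividesˡ x (z ⁻¹) ⟩
    z ⁻¹              ∎
    where open SetoidReasoning setoid

  x∙y⁻¹≈z⇒y≈x∙z⁻¹ : ∀ {x y z} → x ∙ y ⁻¹ ≈ z → y ≈ x ∙ z ⁻¹
  x∙y⁻¹≈z⇒y≈x∙z⁻¹ {y = y} xy⁻¹≈z =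
    sym (trans (y≈x∙z⇒x∙y⁻¹≈z⁻¹ (sym xy⁻¹≈z)) (⁻¹-involutive y))

module TwoSidedAction {c ℓ} (S : Setting c ℓ) where
  open Setting S
  module Ab = AbelianGroup Mod
  open Stabiliser G
  open Differences Mod

  ·-0 : ∀ g → g · 0ₘ ≈ₘ 0ₘ
  ·-0 g = GroupHomomorphism.ε-homo Ab.group (·-cong refl) (·-additive g)

  ◃-0 : ∀ g → 0ₘ ◃ g ≈ₘ 0ₘ
  ◃-0 g = GroupHomomorphism.ε-homo Ab.group (◃-cong refl) (λ x y → ◃-additive x y g)

  ·-neg : ∀ g x → g · (- x) ≈ₘ - (g · x)
  ·-neg g = GroupHomomorphism.⁻¹-homo Ab.group (·-cong refl) (·-additive g)

  ◃-neg : ∀ g x → (- x) ◃ g ≈ₘ - (x ◃ g)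
  ◃-neg g = GroupHomomorphism.⁻¹-homo Ab.group (◃-cong refl) (λ x y → ◃-additive x y g)

  ·-cancel : ∀ {g h} x → g ∙ h ≈ ε → g · (h · x) ≈ₘ x
  ·-cancel x gh≈ε = Ab.trans (Ab.sym (·-assoc _ _ x)) (Ab.trans (·-cong gh≈ε Ab.refl) (·-identity x))

  ◃-cancel : ∀ {g h} x → g ∙ h ≈ ε → (x ◃ g) ◃ h ≈ₘ x
  ◃-cancel x gh≈ε = Ab.trans (Ab.sym (◃-assoc x _ _)) (Ab.trans (◃-cong gh≈ε Ab.refl) (◃-identity x))

  AM+MA-neg : ∀ A m n → - ((A · m) + (n ◃ A)) ≈ₘ (A · (- m)) + ((- n) ◃ A)
  AM+MA-neg A m n = Ab.trans (Ab.sym (AbelianGroupProperties.⁻¹-∙-comm Mod (A · m) (n ◃ A)))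
                             (Ab.sym (Ab.∙-cong (·-neg A m) (◃-neg A n)))

  ⊗-inverse : Carrier × M' → Carrier × M'
  ⊗-inverse (g , m) = g ⁻¹ , - ((g ⁻¹ · m) ◃ g ⁻¹)

  ⊗-cong : ∀ {α α′ β β′} → α ≈̃ α′ → β ≈̃ β′ → (α ⊗ β) ≈̃ (α′ ⊗ β′)
  ⊗-cong (A≈A′ , a≈a′) (B≈B′ , b≈b′) = ∙-cong A≈A′ B≈B′ , Ab.∙-cong (·-cong A≈A′ b≈b′) (◃-cong B≈B′ a≈a′)

  ⊗-assoc : ∀ α β γ → ((α ⊗ β) ⊗ γ) ≈̃ (α ⊗ (β ⊗ γ))
  ⊗-assoc (A , a) (B , b) (C , c) = assoc A B C , (begin
    ((A ∙ B) · c) + (((A · b) + (a ◃ B)) ◃ C)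
      ≈⟨ Ab.∙-cong (·-assoc A B c) (◃-additive (A · b) (a ◃ B) C) ⟩
    (A · (B · c)) + (((A · b) ◃ C) + ((a ◃ B) ◃ C))
      ≈⟨ Ab.∙-congˡ (Ab.∙-cong (·◃-commute A b C) (Ab.sym (◃-assoc a B C))) ⟩
    (A · (B · c)) + ((A · (b ◃ C)) + (a ◃ (B ∙ C)))
      ≈⟨ Ab.assoc _ _ _ ⟨
    ((A · (B · c)) + (A · (b ◃ C))) + (a ◃ (B ∙ C))
      ≈⟨ Ab.∙-congʳ (·-additive A (B · c) (b ◃ C)) ⟨
    (A · ((B · c) + (b ◃ C))) + (a ◃ (B ∙ C)) ∎)
    where open SetoidReasoning Ab.setoid

  ⊗-identityˡ : ∀ α → ((ε , 0ₘ) ⊗ α) ≈̃ α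
  ⊗-identityˡ (A , a) = identityˡ A , Ab.trans (Ab.∙-cong (·-identity a) (◃-0 A)) (Ab.identityʳ a)

  ⊗-identityʳ : ∀ α → (α ⊗ (ε , 0ₘ)) ≈̃ α
  ⊗-identityʳ (A , a) = identityʳ A , Ab.trans (Ab.∙-cong (·-0 A) (◃-identity a)) (Ab.identityˡ a)

  ⊗-inverseˡ : ∀ α → (⊗-inverse α ⊗ α) ≈̃ (ε , 0ₘ)
  ⊗-inverseˡ (g , m) = inverseˡ g , (begin
    (g ⁻¹ · m) + ((- ((g ⁻¹ · m) ◃ g ⁻¹)) ◃ g) ≈⟨ Ab.∙-congˡ (◃-neg g _) ⟩
    (g ⁻¹ · m) + (- (((g ⁻¹ · m) ◃ g ⁻¹) ◃ g)) ≈⟨ Ab.∙-congˡ (Ab.⁻¹-cong (◃-cancel _ (inverseˡ g))) ⟩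
    (g ⁻¹ · m) + (- (g ⁻¹ · m))                ≈⟨ Ab.inverseʳ _ ⟩
    0ₘ                                          ∎)
    where open SetoidReasoning Ab.setoid

  ⊗-inverseʳ : ∀ α → (α ⊗ ⊗-inverse α) ≈̃ (ε , 0ₘ)
  ⊗-inverseʳ (g , m) = inverseʳ g , (begin
    (g · (- ((g ⁻¹ · m) ◃ g ⁻¹))) + (m ◃ g ⁻¹) ≈⟨ Ab.∙-congʳ (·-neg g _) ⟩
    (- (g · ((g ⁻¹ · m) ◃ g ⁻¹))) + (m ◃ g ⁻¹) ≈⟨ Ab.∙-congʳ (Ab.⁻¹-cong (·◃-commute g _ _)) ⟨
    (- ((g · (g ⁻¹ · m)) ◃ g ⁻¹)) + (m ◃ g ⁻¹) ≈⟨ Ab.∙-congʳ (Ab.⁻¹-cong (◃-cong refl (·-cancel m (inverseʳ g)))) ⟩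
    (- (m ◃ g ⁻¹)) + (m ◃ g ⁻¹)                ≈⟨ Ab.inverseˡ _ ⟩
    0ₘ                                          ∎)
    where open SetoidReasoning Ab.setoid

  ⊗-inverse-cong : ∀ {α β} → α ≈̃ β → ⊗-inverse α ≈̃ ⊗-inverse β
  ⊗-inverse-cong (g≈h , m≈n) =
    ⁻¹-cong g≈h , Ab.⁻¹-cong (◃-cong (⁻¹-cong g≈h) (·-cong (⁻¹-cong g≈h) m≈n))

  G̃ : Group c ℓ
  G̃ = record
    { Carrier = Carrier × M'
    ; _≈_ = _≈̃_
    ; _∙_ = _⊗_
    ; ε = ε , 0ₘ
    ; _⁻¹ = ⊗-inverse
    ; isGroup = record
      { isMonoid = record
        { isSemigroup = record
          { isMagma = record
            { isEquivalence = record
              { refl = refl , Ab.refl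
              ; sym = λ (p , q) → sym p , Ab.sym q
              ; trans = λ (p , q) (p′ , q′) → trans p p′ , Ab.trans q q′
              }
            ; ∙-cong = ⊗-cong
            }
          ; assoc = ⊗-assoc
          }
        ; identity = ⊗-identityˡ , ⊗-identityʳ
        }
      ; inverse = ⊗-inverseˡ , ⊗-inverseʳ
      ; ⁻¹-cong = ⊗-inverse-cong
      }
    }

  Γ̃-⊗ : ∀ {α β} → InΓ̃ α → InΓ̃ β → InΓ̃ (α ⊗ β)
  Γ̃-⊗ (Γg , Mm) (Γh , Mn) = Γ-∙ Γg Γh , M-+ (M-· (Γ⊆Δ Γg) Mn) (M-◃ (Γ⊆Δ Γh) Mm)

  Γ̃-inverse : ∀ {α} → InΓ̃ α → InΓ̃ (⊗-inverse α)
  Γ̃-inverse {g , m} (Γg , Mm) = Γ-⁻¹ Γg , M-neg (M-◃ Δg⁻¹ (M-· Δg⁻¹ Mm))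
    where
    Δg⁻¹ : Δ (g ⁻¹)
    Δg⁻¹ = Γ⊆Δ (Γ-⁻¹ Γg)

  module _ {A X Y} (xay≈a : X ∙ A ∙ Y ≈ A) where

    star-stabilised : ∀ a → star A X a ≈ₘ (X · a) ◃ Y
    star-stabilised a = ◃-cong (a⁻¹∙x⁻¹∙a≈y xay≈a) Ab.refl

    ⊗-stabilised : ∀ a m n →
      proj₂ (((X , m) ⊗ (A , a)) ⊗ (Y , n)) ≈ₘ star A X a + ((A · (Y ⁻¹ · n)) + ((m ◃ X ⁻¹) ◃ A))
    ⊗-stabilised a m n = begin
      ((X ∙ A) · n) + (((X · a) + (m ◃ A)) ◃ Y)
        ≈⟨ Ab.∙-cong left-term (Ab.trans (◃-additive (X · a) (m ◃ A) Y) (Ab.∙-congˡ right-term)) ⟩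
      (A · (Y ⁻¹ · n)) + (((X · a) ◃ Y) + ((m ◃ X ⁻¹) ◃ A))
        ≈⟨ CommutativeSemigroupProperties.x∙yz≈y∙xz Ab.commutativeSemigroup _ _ _ ⟩
      ((X · a) ◃ Y) + ((A · (Y ⁻¹ · n)) + ((m ◃ X ⁻¹) ◃ A))
        ≈⟨ Ab.∙-congʳ (star-stabilised a) ⟨
      star A X a + ((A · (Y ⁻¹ · n)) + ((m ◃ X ⁻¹) ◃ A)) ∎
      where
      open SetoidReasoning Ab.setoid
      left-term : (X ∙ A) · n ≈ₘ A · (Y ⁻¹ · n)
      left-term = Ab.trans (·-cong (x∙a≈a∙y⁻¹ xay≈a) Ab.refl) (·-assoc A (Y ⁻¹) n)
      right-term : (m ◃ A) ◃ Y ≈ₘ (m ◃ X ⁻¹) ◃ A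
      right-term = Ab.trans (Ab.sym (◃-assoc m A Y))
                     (Ab.trans (◃-cong (a∙y≈x⁻¹∙a xay≈a) Ab.refl) (◃-assoc m (X ⁻¹) A))

  doubleCoset⇒congMod : ∀ {A a b} → InDoubleCoset (A , a) (A , b) →
                        ∃ λ X → InΓ^ A X × CongMod A (star A X a) b
  doubleCoset⇒congMod {A} {a} ((X , m) , (Y , n) , (ΓX , Mm) , (ΓY , Mn) , A≈XAY , b≈) =
    X , (ΓX , Y ⁻¹ , Γ-⁻¹ ΓY , x≈a∙y⁻¹∙a⁻¹ XAY≈A) ,
    - (Y ⁻¹ · n) , - (m ◃ X ⁻¹) ,
    M-neg (M-· (Γ⊆Δ (Γ-⁻¹ ΓY)) Mn) , M-neg (M-◃ (Γ⊆Δ (Γ-⁻¹ ΓX)) Mm) ,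
    Ab.trans (y≈x∙z⇒x∙y⁻¹≈z⁻¹ (Ab.trans b≈ (⊗-stabilised XAY≈A a m n))) (AM+MA-neg A _ _)
    where
    XAY≈A : X ∙ A ∙ Y ≈ A
    XAY≈A = sym A≈XAY

  congMod⇒doubleCoset : ∀ {A a b} → (∃ λ X → InΓ^ A X × CongMod A (star A X a) b) →
                        InDoubleCoset (A , a) (A , b)
  congMod⇒doubleCoset {A} {a} {b} (X , (ΓX , g , Γg , X≈AgA⁻¹) , m , n , Mm , Mn , star-b≈) =
    (X , (- n) ◃ X) , (g ⁻¹ , g ⁻¹ · (- m)) ,
    (ΓX , M-◃ (Γ⊆Δ ΓX) (M-neg Mn)) , (Γ-⁻¹ Γg , M-· (Γ⊆Δ (Γ-⁻¹ Γg)) (M-neg Mm)) ,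
    sym XAg⁻¹≈A , (begin
      b
        ≈⟨ x∙y⁻¹≈z⇒y≈x∙z⁻¹ star-b≈ ⟩
      star A X a + (- ((A · m) + (n ◃ A)))
        ≈⟨ Ab.∙-congˡ (AM+MA-neg A m n) ⟩
      star A X a + ((A · (- m)) + ((- n) ◃ A))
        ≈⟨ Ab.∙-congˡ (Ab.∙-cong (·-cong refl (·-cancel (- m) (inverseˡ (g ⁻¹))))
                                 (◃-cong refl (◃-cancel (- n) (inverseʳ X)))) ⟨
      star A X a + ((A · ((g ⁻¹) ⁻¹ · (g ⁻¹ · (- m)))) + ((((- n) ◃ X) ◃ X ⁻¹) ◃ A))
        ≈⟨ ⊗-stabilised XAg⁻¹≈A a ((- n) ◃ X) (g ⁻¹ · (- m)) ⟨
      proj₂ (((X , (- n) ◃ X) ⊗ (A , a)) ⊗ (g ⁻¹ , g ⁻¹ · (- m))) ∎)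
    where
    open SetoidReasoning Ab.setoid
    XAg⁻¹≈A : X ∙ A ∙ g ⁻¹ ≈ A
    XAg⁻¹≈A = x≈a∙z∙a⁻¹⇒x∙a∙z⁻¹≈a X≈AgA⁻¹

  doubleCoset⇔congMod : ∀ {A a b} → InDoubleCoset (A , a) (A , b) ⇔
                        (∃ λ X → InΓ^ A X × CongMod A (star A X a) b)
  doubleCoset⇔congMod = mk⇔ doubleCoset⇒congMod congMod⇒doubleCoset

proposition2p1 : ∀ {c ℓ} (S : Setting c ℓ) → let open Setting S in
    ∀ (A : Carrier) (a b : M') → Δ A → M a → M b →
    DoubleCosetEq (A , a) (A , b) ⇔ (∃ λ X → InΓ^ A X × CongMod A (star A X a) b)
proposition2p1 S A a b _ _ _ =
  doubleCoset⇔congMod ⇔-∘ DoubleCosets.doubleCosets-equal⇔ G̃ InΓ̃ (Γ-ε , M-0) Γ̃-⊗ Γ̃-inverse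
  where
  open Setting S
  open TwoSidedAction S
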